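{- Let $q>2$ be a prime power, $n$ a positive integer, $F=\mathbb{F}_{q^{2n+1}}$, and let $W$, $\mathrm{PG}(W)$, $\tilde\Pi_i$ and $\mathcal{V}_{\alpha_1,\dots,\alpha_n}$ be as in the context. Then the $(q^{2n+1}-1)^n$ sets $\mathcal{V}_{\alpha_1,\dots,\alpha_n}$, $(\alpha_1,\dots,\alpha_n)\in(F^*)^n$, form a partition of the set of points of $\mathrm{PG}(W)$ contained in none of the $(2n^2+n-1)$-dimensional subspaces $\langle\tilde\Pi_0,\dots,\tilde\Pi_{i-1},\tilde\Pi_{i+1},\dots,\tilde\Pi_n\rangle$, $0\le i\le n$.
   Context: For $a_0,\dots,a_n\in F$, $M(a_0,\dots,a_n)=(m_{ij})_{0\le i,j\le 2n}$ is the symmetric $(2n+1)\times(2n+1)$ matrix over $F$ with, for $0\le i\le j\le 2n$ and $d=j-i$: $m_{ij}=a_d^{q^i}$ if $d\le n$, and $m_{ij}=a_{2n+1-d}^{q^j}$ if $d>n$; and $m_{ji}=m_{ij}$. $W=\{M(a_0,\dots,a_n):a_i\in F\}$ is an $\mathbb{F}_q$-vector space of dimension $(n+1)(2n+1)$, and $\mathrm{PG}(W)$ is its projective space (points are $1$-dimensional $\mathbb{F}_q$-subspaces). For $0\le i\le n$, $\tilde\Pi_i$ is the $2n$-dimensional subspace of $\mathrm{PG}(W)$ consisting of the points spanned by $M(0,\dots,0,a_i,0,\dots,0)$ ($a_i$ in position $i$), $a_i\in F^*$. For $\alpha_1,\dots,\alpha_n\in F^*$, $\mathcal{V}_{\alpha_1,\dots,\alpha_n}$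 is the set of points spanned by $M(x^2,\alpha_1x^{q+1},\alpha_2x^{q^2+1},\dots,\alpha_nx^{q^n+1})$, $x\in F^*$. -}

module Defs where

open import Level using (0ℓ)
open import Algebra.Bundles using (CommutativeRing)
open import Data.Nat as ℕ using (ℕ; zero; suc; _∸_; _≤?_; _<?_)
open import Data.Fin using (Fin; toℕ; fromℕ<)
open import Data.Fin as Fin using ()
open import Data.List using (List; foldr; map)
open import Data.List as List using ()
open import Data.Fin.Base using ()
open import Data.Product using (Σ; ∃; _×_; _,_)
open import Data.Nat.Primality using (Prime)
open import Relation.Nullary using (¬_; yes; no)
open import Relation.Binary.PropositionalEquality using (_≡_)

IsPrimePower : ℕ → Set
IsPrimePower q = Σ ℕ λ p → Σ ℕ λ k → Prime p × (1 ℕ.≤ k) × (q ≡ p ℕ.^ k)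

record IsField (R : CommutativeRing 0ℓ 0ℓ) : Set where
  open CommutativeRing R
  field
    1≉0 : ¬ (1# ≈ 0#)
    inverse : ∀ x → ¬ (x ≈ 0#) → Σ Carrier λ y → (x * y) ≈ 1#

record HasCard (R : CommutativeRing 0ℓ 0ℓ) (N : ℕ) : Set where
  open CommutativeRing R
  field
    toFin    : Carrier → Fin N
    fromFin  : Fin N → Carrier
    toFin-cong : ∀ {x y} → x ≈ y → toFin x ≡ toFin y
    from-to  : ∀ x → fromFin (toFin x) ≈ x
    to-from  : ∀ i → toFin (fromFin i) ≡ i

module WithField (R : CommutativeRing 0ℓ 0ℓ) (q n : ℕ) where
  open CommutativeRing R

  F : Set
  F = Carrier

  pow : F → ℕ → F
  pow x zero    = 1#
  pow x (suc k) = x * pow x k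

  frob : ℕ → F → F
  frob k x = pow x (q ℕ.^ k)

  InFq : F → Set
  InFq x = pow x q ≈ x

  N : ℕ
  N = suc (2 ℕ.* n)

  Mat : Set
  Mat = Fin N → Fin N → F

  _≋_ : Mat → Mat → Set
  A ≋ B = ∀ i j → A i j ≈ B i j

  scale : F → Mat → Mat
  scale λ₀ A i j = λ₀ * A i j

  _⊕_ : Mat → Mat → Mat
  (A ⊕ B) i j = A i j + B i j

  zeroMat : Mat
  zeroMat i j = 0#

  IsZero : Mat → Set
  IsZero A = ∀ i j → A i j ≈ 0#

  Coeffs : Set
  Coeffs = Fin (suc n) → F

  -- a_k for a natural index k (0 if k > n; never used out of range)
  at : Coeffs → ℕ → F
  at a k with k <? suc n
  ... | yes p = a (fromℕ< p)
  ... | no _  = 0#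

  -- entry m_{ij} for i ≤ j (d = j - i)
  entUp : Coeffs → ℕ → ℕ → F
  entUp a i j with (j ∸ i) ≤? n
  ... | yes _ = frob i (at a (j ∸ i))
  ... | no _  = frob j (at a (N ∸ (j ∸ i)))

  ent : Coeffs → ℕ → ℕ → F
  ent a i j with i ≤? j
  ... | yes _ = entUp a i j
  ... | no _  = entUp a j i

  M : Coeffs → Mat
  M a i j = ent a (toℕ i) (toℕ j)

  InW : Mat → Set
  InW A = Σ Coeffs λ a → A ≋ M a

  single : Fin (suc n) → F → Coeffs
  single i x j with i Fin.≟ j
  ... | yes _ = x
  ... | no _  = 0#

  sumΠ : Coeffs → Mat
  sumΠ b = foldr _⊕_ zeroMat (map (λ j → M (single j (b j))) (List.allFin (suc n)))

  -- A lies in the span <Π̃_0,...,Π̃_{i-1},Π̃_{i+1},...,Π̃_n>: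
  -- A is a sum of elements of the Π̃_j, j ≠ i.
  InSpanExcept : Fin (suc n) → Mat → Set
  InSpanExcept i A = Σ Coeffs λ b → (b i ≈ 0#) × (A ≋ sumΠ b)

  -- A and B span the same projective point (B nonzero): A = λ B, λ ∈ F_q^*
  SamePoint : Mat → Mat → Set
  SamePoint A B = Σ F λ λ₀ → InFq λ₀ × ¬ (λ₀ ≈ 0#) × (A ≋ scale λ₀ B)

  -- α = (α_1,...,α_n), with α_{k+1} stored as α k
  Alphas : Set
  Alphas = Fin n → F

  vCoeffs : Alphas → F → Coeffs
  vCoeffs α x Fin.zero    = x * x
  vCoeffs α x (Fin.suc k) = α k * pow x (q ℕ.^ suc (toℕ k) ℕ.+ 1)

  InV : Alphas → Mat → Set
  InV α A = Σ F λ x → ¬ (x ≈ 0#) × SamePoint A (M (vCoeffs α x))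

  AllNonzero : Alphas → Set
  AllNonzero α = ∀ k → ¬ (α k ≈ 0#)

{-# OPTIONS --safe #-}
-- The first row of M(a) is (a₀, …, aₙ) and every other entry is a fixed Frobenius image
-- a_d ^ q ^ K of a single coefficient. Hence M(μ a) = μ M(a) for μ ∈ F_q, M(a) is the sum of
-- the M(0, …, aⱼ, …, 0), and ⟨M(a)⟩ avoids every span ⟨Π̃ⱼ : j ≠ i⟩ exactly when all aᵢ ≠ 0.
-- The exponent S = (q ^ (2n+1) − 1) / (q − 1) of the norm F → F_q is odd, so ν = a₀ ^ S ∈ F_q*
-- and ν a₀ = x² for x = a₀ ^ ((S + 1) / 2); then M(a) = ν⁻¹ M(x², α₁ x ^ (q+1), …) with
-- α_k = ν a_k / x ^ (q^k + 1). Conversely, if ν x² = μ y² with ν, μ ∈ F_q*, then t = y / x has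
-- t² ∈ F_q; since t and t ^ q have equal squares, equal norms and S is odd, t ^ q = t. So
-- y ^ (q^k + 1) = t² x ^ (q^k + 1) = (ν / μ) x ^ (q^k + 1), and the α_k are determined by the point.
module Submission where

open import Defs
open import Level using (0ℓ)
open import Algebra.Bundles using (CommutativeRing; CommutativeMonoid)
open import Data.Nat as ℕ using (ℕ; zero; suc)
import Data.Nat.Properties as ℕₚ
open import Data.Nat.Solver using (module +-*-Solver)
open import Data.Fin as Fin using (Fin; toℕ; fromℕ<)
import Data.Fin.Properties as Finₚ
open import Data.Fin.Permutation using (Permutation; permutation; _⟨$⟩ʳ_)
open import Data.Vec.Functional using (Vector; replicate; removeAt)
open import Data.List as List using ()
import Data.List.Properties as Listₚ
open import Data.Product using (Σ; ∃-syntax; _×_; _,_; proj₁; proj₂; map₂)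
open import Data.Sum using (_⊎_; inj₁; inj₂)
open import Function using (id; _∘_; _$_)
open import Relation.Nullary using (¬_; yes; no; contradiction)
open import Relation.Binary.Definitions using (Decidable)
open import Relation.Binary.PropositionalEquality as ≡ using (_≡_; _≢_)
import Algebra.Properties.CommutativeMonoid.Sum as MonoidSum
import Algebra.Properties.CommutativeSemiring.Exp as Exp
import Algebra.Solver.CommutativeMonoid as CMSolver

module Repunit (q : ℕ) where
  open import Data.Nat using (_+_; _*_; _^_)

  repunit : ℕ → ℕ
  repunit zero    = 0
  repunit (suc m) = suc (q * repunit m)

  repunit-suc : ∀ m → repunit (suc m) ≡ repunit m + q ^ m
  repunit-suc zero    = ≡.cong suc (ℕₚ.*-zeroʳ q)
  repunit-suc (suc m) = ≡.cong suc $ ≡.trans (≡.cong (q *_) (repunit-suc m))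
                                             (ℕₚ.*-distribˡ-+ q (repunit m) (q ^ m))

  private
    parity : ∀ m → ∃[ r ] (m ≡ 2 * r ⊎ m ≡ suc (2 * r))
    parity zero = 0 , inj₁ ≡.refl
    parity (suc m) with parity m
    ... | r , inj₁ m≡2r   = r , inj₂ (≡.cong suc m≡2r)
    ... | r , inj₂ m≡2r+1 = suc r , inj₁ (≡.trans (≡.cong suc m≡2r+1) (≡.sym (ℕₚ.*-suc 2 r)))

  repunit-odd : ∀ k → ∃[ h ] repunit (suc (2 * k)) ≡ suc (2 * h)
  repunit-odd k with parity q
  ... | r , inj₁ q≡2r = r * repunit (2 * k) ,
    ≡.cong suc (≡.trans (≡.cong (_* repunit (2 * k)) q≡2r) (ℕₚ.*-assoc 2 r (repunit (2 * k))))
  ... | r , inj₂ q≡2r+1 = odd-q k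
    where
    open +-*-Solver
    -- for odd q, q * (1 + q * s) is even whenever s is odd
    step : ∀ h → q * suc (q * suc (2 * h)) ≡ 2 * (q * (suc r + q * h))
    step h rewrite q≡2r+1 = solve 2 (λ r h →
      (con 1 :+ con 2 :* r) :* (con 1 :+ (con 1 :+ con 2 :* r) :* (con 1 :+ con 2 :* h))
      := con 2 :* ((con 1 :+ con 2 :* r) :* (con 1 :+ r :+ (con 1 :+ con 2 :* r) :* h))) ≡.refl r h
    odd-q : ∀ k → ∃[ h ] repunit (suc (2 * k)) ≡ suc (2 * h)
    odd-q zero = 0 , ≡.cong suc (ℕₚ.*-zeroʳ q)
    odd-q (suc k) with odd-q k
    ... | h , e = q * (suc r + q * h) , (begin
      repunit (suc (2 * suc k))               ≡⟨ ≡.cong (repunit ∘ suc) (ℕₚ.*-suc 2 k) ⟩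
      suc (q * suc (q * repunit (suc (2 * k)))) ≡⟨ ≡.cong (λ s → suc (q * suc (q * s))) e ⟩
      suc (q * suc (q * suc (2 * h)))          ≡⟨ ≡.cong suc (step h) ⟩
      suc (2 * (q * (suc r + q * h)))          ∎)
      where open ≡.≡-Reasoning

module FieldProperties (R : CommutativeRing 0ℓ 0ℓ) (isField : IsField R) where
  open CommutativeRing R
  open IsField isField
  open Exp commutativeSemiring using (_^_)
  open MonoidSum *-commutativeMonoid using () renaming (sum to ∏)
  open import Relation.Binary.Reasoning.Setoid setoid

  _⁻¹⟨_⟩ : (x : Carrier) → x ≉ 0# → Carrier
  x ⁻¹⟨ x≉0 ⟩ = proj₁ (inverse x x≉0)

  *-inverseʳ : ∀ x (x≉0 : x ≉ 0#) → x * x ⁻¹⟨ x≉0 ⟩ ≈ 1#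
  *-inverseʳ x x≉0 = proj₂ (inverse x x≉0)

  *-inverseˡ : ∀ x (x≉0 : x ≉ 0#) → x ⁻¹⟨ x≉0 ⟩ * x ≈ 1#
  *-inverseˡ x x≉0 = trans (*-comm _ x) (*-inverseʳ x x≉0)

  ⁻¹-nonzero : ∀ {x} (x≉0 : x ≉ 0#) → x ⁻¹⟨ x≉0 ⟩ ≉ 0#
  ⁻¹-nonzero {x} x≉0 x⁻¹≈0 = 1≉0 $ begin
    1#              ≈⟨ *-inverseʳ x x≉0 ⟨
    x * x ⁻¹⟨ x≉0 ⟩ ≈⟨ *-congˡ x⁻¹≈0 ⟩
    x * 0#          ≈⟨ zeroʳ x ⟩
    0#              ∎

  *-cancelˡ-nonzero : ∀ {x y z} → x ≉ 0# → x * y ≈ x * z → y ≈ z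
  *-cancelˡ-nonzero {x} {y} {z} x≉0 xy≈xz = begin
    y                     ≈⟨ *-identityˡ y ⟨
    1# * y                ≈⟨ *-congʳ (*-inverseˡ x x≉0) ⟨
    (x ⁻¹⟨ x≉0 ⟩ * x) * y ≈⟨ *-assoc _ x y ⟩
    x ⁻¹⟨ x≉0 ⟩ * (x * y) ≈⟨ *-congˡ xy≈xz ⟩
    x ⁻¹⟨ x≉0 ⟩ * (x * z) ≈⟨ *-assoc _ x z ⟨
    (x ⁻¹⟨ x≉0 ⟩ * x) * z ≈⟨ *-congʳ (*-inverseˡ x x≉0) ⟩
    1# * z                ≈⟨ *-identityˡ z ⟩
    z                     ∎

  *-cancelʳ-nonzero : ∀ {x y z} → z ≉ 0# → x * z ≈ y * z → x ≈ y
  *-cancelʳ-nonzero {x} {y} {z} z≉0 xz≈yz =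
    *-cancelˡ-nonzero z≉0 (trans (*-comm z x) (trans xz≈yz (*-comm y z)))

  *-nonzero : ∀ {x y} → x ≉ 0# → y ≉ 0# → x * y ≉ 0#
  *-nonzero {x} {y} x≉0 y≉0 xy≈0 = y≉0 (*-cancelˡ-nonzero x≉0 (trans xy≈0 (sym (zeroʳ x))))

  ^-nonzero : ∀ {x} k → x ≉ 0# → x ^ k ≉ 0#
  ^-nonzero zero    x≉0 = 1≉0
  ^-nonzero (suc k) x≉0 = *-nonzero x≉0 (^-nonzero k x≉0)

  ∏-nonzero : ∀ {m} (f : Vector Carrier m) → (∀ i → f i ≉ 0#) → ∏ f ≉ 0#
  ∏-nonzero {zero}  f f≉0 = 1≉0
  ∏-nonzero {suc m} f f≉0 = *-nonzero (f≉0 Fin.zero) (∏-nonzero (f ∘ Fin.suc) (f≉0 ∘ Fin.suc))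

module CommutativeMonoidSum {c ℓ} (M : CommutativeMonoid c ℓ) where
  open CommutativeMonoid M
  open MonoidSum M public

  sum-onlyAt : ∀ {m} (f : Vector Carrier m) i → (∀ j → j ≢ i → f j ≈ ε) → sum f ≈ f i
  sum-onlyAt {suc m} f i f≈ε = begin
    sum f                    ≈⟨ sum-remove f ⟩
    f i ∙ sum (removeAt f i) ≈⟨ ∙-congˡ (sum-cong-≋ (λ j → f≈ε _ (Finₚ.punchInᵢ≢i i j))) ⟩
    f i ∙ sum (replicate m ε) ≈⟨ ∙-congˡ (sum-replicate-zero m) ⟩
    f i ∙ ε                  ≈⟨ identityʳ (f i) ⟩
    f i                      ∎
    where open import Relation.Binary.Reasoning.Setoid setoid

module FiniteFieldProperties (R : CommutativeRing 0ℓ 0ℓ) (isField : IsField R)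
                             {Q : ℕ} (card : HasCard R Q) where
  open CommutativeRing R
  open IsField isField
  open HasCard card
  open FieldProperties R isField
  open Exp commutativeSemiring using (_^_)
  open CommutativeMonoidSum *-commutativeMonoid using (sum-onlyAt; sum-cong-≋; ∑-distrib-+; sum-permute; sum-replicate)
    renaming (sum to ∏)
  open import Relation.Binary.Reasoning.Setoid setoid

  _≟_ : Decidable _≈_
  x ≟ y with toFin x Fin.≟ toFin y
  ... | yes same = yes $ begin
    x                ≈⟨ from-to x ⟨
    fromFin (toFin x) ≡⟨ ≡.cong fromFin same ⟩
    fromFin (toFin y) ≈⟨ from-to y ⟩
    y                ∎
  ... | no differ = no (differ ∘ toFin-cong)

  ifZero_then_else_ : Carrier → Carrier → Carrier → Carrier
  ifZero y then u else v with y ≟ 0#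
  ... | yes _ = u
  ... | no  _ = v

  ifZero-yes : ∀ {y} u v → y ≈ 0# → ifZero y then u else v ≈ u
  ifZero-yes {y} u v y≈0 with y ≟ 0#
  ... | yes _   = refl
  ... | no y≉0 = contradiction y≈0 y≉0

  ifZero-no : ∀ {y} u v → y ≉ 0# → ifZero y then u else v ≈ v
  ifZero-no {y} u v y≉0 with y ≟ 0#
  ... | yes y≈0 = contradiction y≈0 y≉0
  ... | no _    = refl

  -- Replacing 0# by 1# makes the product of all elements invertible.
  unitOrOne : Carrier → Carrier
  unitOrOne y = ifZero y then 1# else y

  unitOrOne-nonzero : ∀ y → unitOrOne y ≉ 0#
  unitOrOne-nonzero y with y ≟ 0#
  ... | yes _   = 1≉0
  ... | no y≉0 = y≉0

  unitOrOne-cong : ∀ {y y′} → y ≈ y′ → unitOrOne y ≈ unitOrOne y′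
  unitOrOne-cong {y} {y′} y≈y′ with y ≟ 0#
  ... | yes y≈0 = sym (ifZero-yes 1# y′ (trans (sym y≈y′) y≈0))
  ... | no y≉0 = trans y≈y′ (sym (ifZero-no 1# y′ (y≉0 ∘ trans y≈y′)))

  module _ {a : Carrier} (a≉0 : a ≉ 0#) where

    scaling : Permutation Q Q
    scaling = permutation (λ i → toFin (a * fromFin i)) (λ i → toFin (a ⁻¹⟨ a≉0 ⟩ * fromFin i))
      (λ i → ≡.trans (toFin-cong (cancel (*-inverseʳ a a≉0))) (to-from i))
      (λ i → ≡.trans (toFin-cong (cancel (*-inverseˡ a a≉0))) (to-from i))
      where
      cancel : ∀ {b c y} → b * c ≈ 1# → b * fromFin (toFin (c * y)) ≈ y
      cancel {b} {c} {y} bc≈1 = begin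
        b * fromFin (toFin (c * y)) ≈⟨ *-congˡ (from-to (c * y)) ⟩
        b * (c * y)                 ≈⟨ *-assoc b c y ⟨
        (b * c) * y                 ≈⟨ *-congʳ bc≈1 ⟩
        1# * y                      ≈⟨ *-identityˡ y ⟩
        y                           ∎

    scale-unitOrOne : ∀ y → a * unitOrOne y ≈ unitOrOne (a * y) * (ifZero y then a else 1#)
    scale-unitOrOne y with y ≟ 0#
    ... | yes y≈0 = begin
      a * 1#                 ≈⟨ *-comm a 1# ⟩
      1# * a                 ≈⟨ *-congʳ (ifZero-yes 1# (a * y) (trans (*-congˡ y≈0) (zeroʳ a))) ⟨
      unitOrOne (a * y) * a  ∎
    ... | no y≉0 = begin
      a * y                  ≈⟨ *-identityʳ (a * y) ⟨
      (a * y) * 1#           ≈⟨ *-congʳ (ifZero-no 1# (a * y) (*-nonzero a≉0 y≉0)) ⟨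
      unitOrOne (a * y) * 1# ∎

    -- As y ↦ a * y permutes F, the product of all a * unitOrOne y is P up to the single factor a from y = 0.
    fermat-nonzero : a ^ Q ≈ a
    fermat-nonzero = *-cancelʳ-nonzero (∏-nonzero (unitOrOne ∘ fromFin) (unitOrOne-nonzero ∘ fromFin)) $ begin
      a ^ Q * P                                  ≈⟨ *-congʳ (sum-replicate Q) ⟨
      ∏ (replicate Q a) * P                      ≈⟨ ∑-distrib-+ (replicate Q a) (unitOrOne ∘ fromFin) ⟨
      ∏ (λ i → a * unitOrOne (fromFin i))        ≈⟨ sum-cong-≋ (scale-unitOrOne ∘ fromFin) ⟩
      ∏ (λ i → unitOrOne (a * fromFin i) * χ i)  ≈⟨ ∑-distrib-+ (unitOrOne ∘ (a *_) ∘ fromFin) χ ⟩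
      ∏ (unitOrOne ∘ (a *_) ∘ fromFin) * ∏ χ     ≈⟨ *-cong (sum-cong-≋ (λ i → unitOrOne-cong (sym (from-to (a * fromFin i)))))
                                                           (sum-onlyAt χ (toFin 0#) χ≈1) ⟩
      ∏ (unitOrOne ∘ fromFin ∘ (scaling ⟨$⟩ʳ_)) * χ (toFin 0#)
                                                 ≈⟨ *-cong (sym (sum-permute (unitOrOne ∘ fromFin) scaling))
                                                           (ifZero-yes a 1# (from-to 0#)) ⟩
      P * a                                      ≈⟨ *-comm P a ⟩
      a * P                                      ∎
      where
      P = ∏ (unitOrOne ∘ fromFin)
      χ : Vector Carrier Q
      χ i = ifZero fromFin i then a else 1#
      χ≈1 : ∀ i → i ≢ toFin 0# → χ i ≈ 1#
      χ≈1 i i≢0 = ifZero-no a 1# (λ i≈0 → i≢0 (≡.trans (≡.sym (to-from i)) (toFin-cong i≈0)))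

module Subfield (R : CommutativeRing 0ℓ 0ℓ) (isField : IsField R) (q n : ℕ)
                (card : HasCard R (q ℕ.^ suc (2 ℕ.* n))) where
  open CommutativeRing R
  open FieldProperties R isField
  open FiniteFieldProperties R isField card using (fermat-nonzero)
  open Repunit q
  open WithField R q n
  module E = Exp commutativeSemiring
  open CMSolver *-commutativeMonoid using (solve; _⊜_) renaming (_⊕_ to _⊛_)
  open import Relation.Binary.Reasoning.Setoid setoid

  pow≡^ : ∀ x k → pow x k ≡ x E.^ k
  pow≡^ x zero    = ≡.refl
  pow≡^ x (suc k) = ≡.cong (x *_) (pow≡^ x k)

  pow-cong : ∀ {x y} k → x ≈ y → pow x k ≈ pow y k
  pow-cong {x} {y} k x≈y rewrite pow≡^ x k | pow≡^ y k = E.^-congˡ k x≈y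

  pow-+ : ∀ x a b → pow x (a ℕ.+ b) ≈ pow x a * pow x b
  pow-+ x a b rewrite pow≡^ x (a ℕ.+ b) | pow≡^ x a | pow≡^ x b = E.^-homo-* x a b

  pow-* : ∀ x a b → pow x (a ℕ.* b) ≈ pow (pow x a) b
  pow-* x a b rewrite pow≡^ x (a ℕ.* b) | pow≡^ x a | pow≡^ (x E.^ a) b = sym (E.^-assocʳ x a b)

  pow-distrib : ∀ x y k → pow (x * y) k ≈ pow x k * pow y k
  pow-distrib x y k rewrite pow≡^ (x * y) k | pow≡^ x k | pow≡^ y k = E.^-distrib-* x y k

  pow-nonzero : ∀ {x} k → x ≉ 0# → pow x k ≉ 0#
  pow-nonzero {x} k rewrite pow≡^ x k = ^-nonzero k

  pow-identityʳ : ∀ x → pow x 1 ≈ x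
  pow-identityʳ = *-identityʳ

  pow-1# : ∀ k → pow 1# k ≈ 1#
  pow-1# zero    = refl
  pow-1# (suc k) = trans (*-identityˡ _) (pow-1# k)

  pow-0# : ∀ k → k ≢ 0 → pow 0# k ≈ 0#
  pow-0# zero    k≢0 = contradiction ≡.refl k≢0
  pow-0# (suc k) _   = zeroˡ _

  pow-pow-comm : ∀ x a b → pow (pow x a) b ≈ pow (pow x b) a
  pow-pow-comm x a b = begin
    pow (pow x a) b ≈⟨ pow-* x a b ⟨
    pow x (a ℕ.* b) ≡⟨ ≡.cong (pow x) (ℕₚ.*-comm a b) ⟩
    pow x (b ℕ.* a) ≈⟨ pow-* x b a ⟩
    pow (pow x b) a ∎

  pow-odd : ∀ x h → pow x (suc (2 ℕ.* h)) ≈ pow (x * x) h * x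
  pow-odd x h = begin
    x * pow x (2 ℕ.* h)   ≈⟨ *-congˡ (pow-* x 2 h) ⟩
    x * pow (pow x 2) h   ≈⟨ *-congˡ (pow-cong h (*-congˡ (*-identityʳ x))) ⟩
    x * pow (x * x) h     ≈⟨ *-comm x _ ⟩
    pow (x * x) h * x     ∎

  fermat : ∀ {x} → x ≉ 0# → frob N x ≈ x
  fermat {x} rewrite pow≡^ x (q ℕ.^ N) = fermat-nonzero

  InFq-cong : ∀ {x y} → x ≈ y → InFq x → InFq y
  InFq-cong {x} {y} x≈y x∈Fq = trans (pow-cong q (sym x≈y)) (trans x∈Fq x≈y)

  InFq-1# : InFq 1#
  InFq-1# = pow-1# q

  InFq-* : ∀ {x y} → InFq x → InFq y → InFq (x * y)
  InFq-* {x} {y} x∈Fq y∈Fq = trans (pow-distrib x y q) (*-cong x∈Fq y∈Fq)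

  InFq-⁻¹ : ∀ {x} (x≉0 : x ≉ 0#) → InFq x → InFq (x ⁻¹⟨ x≉0 ⟩)
  InFq-⁻¹ {x} x≉0 x∈Fq = *-cancelʳ-nonzero x≉0 $ begin
    pow x⁻¹ q * x        ≈⟨ *-congˡ x∈Fq ⟨
    pow x⁻¹ q * pow x q  ≈⟨ pow-distrib x⁻¹ x q ⟨
    pow (x⁻¹ * x) q      ≈⟨ pow-cong q (*-inverseˡ x x≉0) ⟩
    pow 1# q             ≈⟨ InFq-1# ⟩
    1#                   ≈⟨ *-inverseˡ x x≉0 ⟨
    x⁻¹ * x              ∎
    where x⁻¹ = x ⁻¹⟨ x≉0 ⟩

  frob-InFq : ∀ {x} → InFq x → ∀ k → frob k x ≈ x
  frob-InFq {x} x∈Fq zero    = pow-identityʳ x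
  frob-InFq {x} x∈Fq (suc k) = begin
    pow x (q ℕ.* q ℕ.^ k)    ≈⟨ pow-* x q (q ℕ.^ k) ⟩
    pow (pow x q) (q ℕ.^ k)  ≈⟨ pow-cong (q ℕ.^ k) x∈Fq ⟩
    frob k x                 ≈⟨ frob-InFq x∈Fq k ⟩
    x                        ∎

  -- The norm of F over F_q, as the power with exponent (q ^ N - 1) / (q - 1).
  norm : F → F
  norm x = pow x (repunit N)

  norm-nonzero : ∀ {x} → x ≉ 0# → norm x ≉ 0#
  norm-nonzero = pow-nonzero (repunit N)

  norm-InFq : ∀ {x} → x ≉ 0# → InFq (norm x)
  norm-InFq {x} x≉0 = *-cancelʳ-nonzero x≉0 $ begin
    pow (norm x) q * x         ≈⟨ *-cong (pow-* x S q) (pow-identityʳ x) ⟨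
    pow x (S ℕ.* q) * pow x 1  ≈⟨ pow-+ x (S ℕ.* q) 1 ⟨
    pow x (S ℕ.* q ℕ.+ 1)      ≡⟨ ≡.cong (pow x) S*q+1≡S+q^N ⟩
    pow x (S ℕ.+ q ℕ.^ N)      ≈⟨ pow-+ x S (q ℕ.^ N) ⟩
    norm x * frob N x          ≈⟨ *-congˡ (fermat x≉0) ⟩
    norm x * x                 ∎
    where
    S = repunit N
    S*q+1≡S+q^N : S ℕ.* q ℕ.+ 1 ≡ S ℕ.+ q ℕ.^ N
    S*q+1≡S+q^N = ≡.trans (ℕₚ.+-comm _ 1) (≡.trans (≡.cong suc (ℕₚ.*-comm S q)) (repunit-suc N))

  InFq-of-square : ∀ {t} → t ≉ 0# → InFq (t * t) → InFq t
  InFq-of-square {t} t≉0 tt∈Fq with repunit-odd n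
  ... | h , S≡2h+1 = *-cancelˡ-nonzero (pow-nonzero h (*-nonzero t≉0 t≉0)) $ begin
    pow (t * t) h * u              ≈⟨ *-congʳ (pow-cong h uu≈tt) ⟨
    pow (u * u) h * u              ≈⟨ pow-odd u h ⟨
    pow u (suc (2 ℕ.* h))          ≡⟨ ≡.cong (pow u) S≡2h+1 ⟨
    pow (pow t q) (repunit N)      ≈⟨ pow-pow-comm t q (repunit N) ⟩
    pow (norm t) q                 ≈⟨ norm-InFq t≉0 ⟩
    norm t                         ≡⟨ ≡.cong (pow t) S≡2h+1 ⟩
    pow t (suc (2 ℕ.* h))          ≈⟨ pow-odd t h ⟩
    pow (t * t) h * t              ∎
    where
    u = pow t q
    uu≈tt : u * u ≈ t * t
    uu≈tt = trans (sym (pow-distrib t t q)) tt∈Fq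

  norm*self-square : ∀ {a} → a ≉ 0# → Σ F λ x → x ≉ 0# × x * x ≈ norm a * a
  norm*self-square {a} a≉0 with repunit-odd n
  ... | h , S≡2h+1 = x , pow-nonzero (suc h) a≉0 , (begin
    (a * p) * (a * p)          ≈⟨ solve 2 (λ a p → (a ⊛ p) ⊛ (a ⊛ p) ⊜ (p ⊛ p) ⊛ (a ⊛ a)) refl a p ⟩
    (p * p) * (a * a)          ≈⟨ *-congʳ (pow-distrib a a h) ⟨
    pow (a * a) h * (a * a)    ≈⟨ *-assoc _ a a ⟨
    (pow (a * a) h * a) * a    ≈⟨ *-congʳ (pow-odd a h) ⟨
    pow a (suc (2 ℕ.* h)) * a  ≡⟨ ≡.cong (λ e → pow a e * a) S≡2h+1 ⟨
    norm a * a                 ∎)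
    where
    p = pow a h
    x = a * p

  ratio-InFq : ∀ {ν μ x y} → InFq ν → InFq μ → μ ≉ 0# → x ≉ 0# → y ≉ 0# →
               ν * (x * x) ≈ μ * (y * y) → Σ F λ t → InFq t × y ≈ t * x × ν ≈ μ * (t * t)
  ratio-InFq {ν} {μ} {x} {y} ν∈Fq μ∈Fq μ≉0 x≉0 y≉0 νxx≈μyy = t , t∈Fq , y≈tx , ν≈μtt
    where
    t = y * x ⁻¹⟨ x≉0 ⟩
    y≈tx : y ≈ t * x
    y≈tx = sym $ begin
      (y * x ⁻¹⟨ x≉0 ⟩) * x ≈⟨ *-assoc y _ x ⟩
      y * (x ⁻¹⟨ x≉0 ⟩ * x) ≈⟨ *-congˡ (*-inverseˡ x x≉0) ⟩
      y * 1#                ≈⟨ *-identityʳ y ⟩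
      y                     ∎
    ν≈μtt : ν ≈ μ * (t * t)
    ν≈μtt = *-cancelʳ-nonzero (*-nonzero x≉0 x≉0) $ begin
      ν * (x * x)              ≈⟨ νxx≈μyy ⟩
      μ * (y * y)              ≈⟨ *-congˡ (*-cong y≈tx y≈tx) ⟩
      μ * ((t * x) * (t * x))  ≈⟨ solve 3 (λ μ t x → μ ⊛ ((t ⊛ x) ⊛ (t ⊛ x)) ⊜ (μ ⊛ (t ⊛ t)) ⊛ (x ⊛ x)) refl μ t x ⟩
      (μ * (t * t)) * (x * x)  ∎
    μ⁻¹ = μ ⁻¹⟨ μ≉0 ⟩
    tt≈νμ⁻¹ : t * t ≈ ν * μ⁻¹
    tt≈νμ⁻¹ = *-cancelˡ-nonzero μ≉0 $ begin
      μ * (t * t)      ≈⟨ ν≈μtt ⟨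
      ν                ≈⟨ *-identityʳ ν ⟨
      ν * 1#           ≈⟨ *-congˡ (*-inverseʳ μ μ≉0) ⟨
      ν * (μ * μ⁻¹)    ≈⟨ solve 3 (λ ν μ μ⁻¹ → ν ⊛ (μ ⊛ μ⁻¹) ⊜ μ ⊛ (ν ⊛ μ⁻¹)) refl ν μ μ⁻¹ ⟩
      μ * (ν * μ⁻¹)    ∎
    t∈Fq : InFq t
    t∈Fq = InFq-of-square (*-nonzero y≉0 (⁻¹-nonzero x≉0))
             (InFq-cong (sym tt≈νμ⁻¹) (InFq-* ν∈Fq (InFq-⁻¹ μ≉0 μ∈Fq)))

  twist : ℕ → F → F
  twist K x = pow x (q ℕ.^ K ℕ.+ 1)

  twist-InFq-* : ∀ {t} → InFq t → ∀ K x → twist K (t * x) ≈ (t * t) * twist K x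
  twist-InFq-* {t} t∈Fq K x = begin
    twist K (t * x)                            ≈⟨ pow-distrib t x (q ℕ.^ K ℕ.+ 1) ⟩
    pow t (q ℕ.^ K ℕ.+ 1) * twist K x          ≈⟨ *-congʳ (pow-+ t (q ℕ.^ K) 1) ⟩
    (frob K t * pow t 1) * twist K x           ≈⟨ *-congʳ (*-cong (frob-InFq t∈Fq K) (pow-identityʳ t)) ⟩
    (t * t) * twist K x                        ∎

  twist-coefficient-unique : ∀ K {ν μ x y α β} → InFq ν → InFq μ → ν ≉ 0# → μ ≉ 0# → x ≉ 0# → y ≉ 0# →
    ν * (x * x) ≈ μ * (y * y) → ν * (α * twist K x) ≈ μ * (β * twist K y) → α ≈ β
  twist-coefficient-unique K {ν} {μ} {x} {y} {α} {β} ν∈Fq μ∈Fq ν≉0 μ≉0 x≉0 y≉0 νxx≈μyy να≈μβ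
    with ratio-InFq ν∈Fq μ∈Fq μ≉0 x≉0 y≉0 νxx≈μyy
  ... | t , t∈Fq , y≈tx , ν≈μtt = *-cancelʳ-nonzero (*-nonzero ν≉0 (pow-nonzero (q ℕ.^ K ℕ.+ 1) x≉0)) $ begin
    α * (ν * X)                 ≈⟨ solve 3 (λ α ν X → α ⊛ (ν ⊛ X) ⊜ ν ⊛ (α ⊛ X)) refl α ν X ⟩
    ν * (α * X)                 ≈⟨ να≈μβ ⟩
    μ * (β * twist K y)         ≈⟨ *-congˡ (*-congˡ (pow-cong (q ℕ.^ K ℕ.+ 1) y≈tx)) ⟩
    μ * (β * twist K (t * x))   ≈⟨ *-congˡ (*-congˡ (twist-InFq-* t∈Fq K x)) ⟩
    μ * (β * ((t * t) * X))     ≈⟨ solve 4 (λ μ β s X → μ ⊛ (β ⊛ (s ⊛ X)) ⊜ β ⊛ ((μ ⊛ s) ⊛ X)) refl μ β (t * t) X ⟩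
    β * ((μ * (t * t)) * X)     ≈⟨ *-congˡ (*-congʳ ν≈μtt) ⟨
    β * (ν * X)                 ∎
    where X = twist K x

module Partition (R : CommutativeRing 0ℓ 0ℓ) (isField : IsField R) (q n : ℕ) (q≢0 : q ≢ 0)
                 (card : HasCard R (q ℕ.^ suc (2 ℕ.* n))) where
  open CommutativeRing R
  open IsField isField using (1≉0)
  open FieldProperties R isField
  open Subfield R isField q n card
  open WithField R q n
  open CMSolver *-commutativeMonoid using (solve; _⊜_) renaming (_⊕_ to _⊛_)
  open CommutativeMonoidSum +-commutativeMonoid using (sum-onlyAt) renaming (sum to ∑)
  open import Relation.Binary.Reasoning.Setoid setoid

  at-in-range : ∀ {D} → D ℕ.< suc n → Σ (Fin (suc n)) λ d → ∀ c → at c D ≡ c d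
  at-in-range {D} D<1+n with D ℕ.<? suc n
  ... | yes D<1+n′ = fromℕ< D<1+n′ , λ c → ≡.refl
  ... | no  D≮1+n  = contradiction D<1+n D≮1+n

  -- Beyond the n-th superdiagonal, the entry at distance d carries the coefficient a_{2n+1-d}.
  N∸d≤n : ∀ {d} → n ℕ.< d → N ℕ.∸ d ℕ.≤ n
  N∸d≤n n<d = ℕₚ.≤-trans (ℕₚ.∸-monoʳ-≤ N n<d)
                         (ℕₚ.≤-reflexive (≡.trans (ℕₚ.m+n∸m≡n n (n ℕ.+ 0)) (ℕₚ.+-identityʳ n)))

  entUp-frob : ∀ i j → Σ ℕ λ K → Σ (Fin (suc n)) λ d → ∀ c → entUp c i j ≡ frob K (c d)
  entUp-frob i j with (j ℕ.∸ i) ℕ.≤? n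
  ... | yes d≤n with at-in-range (ℕ.s≤s d≤n)
  ...   | d , at≡ = i , d , ≡.cong (frob i) ∘ at≡
  entUp-frob i j | no d≰n with at-in-range (ℕ.s≤s (N∸d≤n (ℕₚ.≰⇒> d≰n)))
  ...   | d , at≡ = j , d , ≡.cong (frob j) ∘ at≡

  M-frob : ∀ (i j : Fin N) → Σ ℕ λ K → Σ (Fin (suc n)) λ d → ∀ c → M c i j ≡ frob K (c d)
  M-frob i j with toℕ i ℕ.≤? toℕ j
  ... | yes _ = entUp-frob (toℕ i) (toℕ j)
  ... | no  _ = entUp-frob (toℕ j) (toℕ i)

  frob-zero : ∀ K → frob K 0# ≈ 0#
  frob-zero K = pow-0# (q ℕ.^ K) (q≢0 ∘ ℕₚ.m^n≡0⇒m≡0 q K)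

  M-cong : ∀ {c c′} → (∀ k → c k ≈ c′ k) → M c ≋ M c′
  M-cong {c} {c′} c≈c′ i j with M-frob i j
  ... | K , d , M≡ = begin
    M c i j       ≡⟨ M≡ c ⟩
    frob K (c d)  ≈⟨ pow-cong (q ℕ.^ K) (c≈c′ d) ⟩
    frob K (c′ d) ≡⟨ M≡ c′ ⟨
    M c′ i j      ∎

  scaleCoeffs : F → Coeffs → Coeffs
  scaleCoeffs μ c k = μ * c k

  M-scale : ∀ {μ} → InFq μ → ∀ c → scale μ (M c) ≋ M (scaleCoeffs μ c)
  M-scale {μ} μ∈Fq c i j with M-frob i j
  ... | K , d , M≡ = begin
    μ * M c i j               ≡⟨ ≡.cong (μ *_) (M≡ c) ⟩
    μ * frob K (c d)          ≈⟨ *-congʳ (frob-InFq μ∈Fq K) ⟨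
    frob K μ * frob K (c d)   ≈⟨ pow-distrib μ (c d) (q ℕ.^ K) ⟨
    frob K (μ * c d)          ≡⟨ M≡ (scaleCoeffs μ c) ⟨
    M (scaleCoeffs μ c) i j   ∎

  inject : Fin (suc n) → Fin N
  inject k = Fin.inject≤ k (ℕ.s≤s (ℕₚ.m≤m+n n (n ℕ.+ 0)))

  at-toℕ : ∀ c k → at c (toℕ k) ≡ c k
  at-toℕ c k with toℕ k ℕ.<? suc n
  ... | yes k<1+n = ≡.cong c (Finₚ.fromℕ<-toℕ k k<1+n)
  ... | no  k≮1+n = contradiction (Finₚ.toℕ<n k) k≮1+n

  ent-firstRow : ∀ c m → m ℕ.≤ n → ent c 0 m ≈ at c m
  ent-firstRow c m m≤n with 0 ℕ.≤? m
  ... | no 0≰m = contradiction ℕ.z≤n 0≰m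
  ... | yes _ with m ℕ.≤? n
  ...   | yes _   = pow-identityʳ (at c m)
  ...   | no m≰n = contradiction m≤n m≰n

  M-firstRow : ∀ c k → M c Fin.zero (inject k) ≈ c k
  M-firstRow c k = begin
    ent c 0 (toℕ (inject k)) ≡⟨ ≡.cong (ent c 0) (Finₚ.toℕ-inject≤ k _) ⟩
    ent c 0 (toℕ k)          ≈⟨ ent-firstRow c (toℕ k) (ℕₚ.≤-pred (Finₚ.toℕ<n k)) ⟩
    at c (toℕ k)             ≡⟨ at-toℕ c k ⟩
    c k                      ∎

  single-same : ∀ d x → single d x d ≈ x
  single-same d x with d Fin.≟ d
  ... | yes _   = refl
  ... | no d≢d = contradiction ≡.refl d≢d

  single-other : ∀ {l d} x → l ≢ d → single l x d ≈ 0#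
  single-other {l} {d} x l≢d with l Fin.≟ d
  ... | yes l≡d = contradiction l≡d l≢d
  ... | no _    = refl

  foldr-⊕-tabulate : ∀ {m} (A : Fin m → Mat) i j →
                     List.foldr _⊕_ zeroMat (List.tabulate A) i j ≡ ∑ (λ l → A l i j)
  foldr-⊕-tabulate {zero}  A i j = ≡.refl
  foldr-⊕-tabulate {suc m} A i j = ≡.cong (A Fin.zero i j +_) (foldr-⊕-tabulate (A ∘ Fin.suc) i j)

  sumΠ≋M : ∀ c → sumΠ c ≋ M c
  sumΠ≋M c i j with M-frob i j
  ... | K , d , M≡ = begin
    sumΠ c i j                                   ≡⟨ ≡.cong (λ L → List.foldr _⊕_ zeroMat L i j)
                                                              (Listₚ.map-tabulate id Π) ⟩
    List.foldr _⊕_ zeroMat (List.tabulate Π) i j ≡⟨ foldr-⊕-tabulate Π i j ⟩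
    ∑ (λ l → Π l i j)                            ≈⟨ sum-onlyAt (λ l → Π l i j) d vanish ⟩
    Π d i j                                      ≡⟨ M≡ (single d (c d)) ⟩
    frob K (single d (c d) d)                    ≈⟨ pow-cong (q ℕ.^ K) (single-same d (c d)) ⟩
    frob K (c d)                                 ≡⟨ M≡ c ⟨
    M c i j                                      ∎
    where
    Π : Fin (suc n) → Mat
    Π l = M (single l (c l))
    vanish : ∀ l → l ≢ d → Π l i j ≈ 0#
    vanish l l≢d = trans (reflexive (M≡ (single l (c l))))
                         (trans (pow-cong (q ℕ.^ K) (single-other (c l) l≢d)) (frob-zero K))

  vCoeffs-nonzero : ∀ {α} → AllNonzero α → ∀ {x} → x ≉ 0# → ∀ k → vCoeffs α x k ≉ 0#
  vCoeffs-nonzero α≉0 x≉0 Fin.zero    = *-nonzero x≉0 x≉0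
  vCoeffs-nonzero α≉0 x≉0 (Fin.suc k) = *-nonzero (α≉0 k) (pow-nonzero (q ℕ.^ suc (toℕ k) ℕ.+ 1) x≉0)

  nonzeroCoeffs⇒InV : ∀ {a} → (∀ k → a k ≉ 0#) → Σ Alphas λ α → AllNonzero α × InV α (M a)
  nonzeroCoeffs⇒InV {a} a≉0 with norm*self-square (a≉0 Fin.zero)
  ... | x , x≉0 , xx≈νa₀ = α , α≉0 , x , x≉0 , μ , μ∈Fq , ⁻¹-nonzero ν≉0 ,
        λ i j → trans (M-cong a≈μv i j) (sym (M-scale μ∈Fq (vCoeffs α x) i j))
    where
    a₀ = a Fin.zero
    ν = norm a₀
    ν≉0 = norm-nonzero (a≉0 Fin.zero)
    μ = ν ⁻¹⟨ ν≉0 ⟩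
    μ∈Fq = InFq-⁻¹ ν≉0 (norm-InFq (a≉0 Fin.zero))
    T : Fin n → F
    T k = twist (suc (toℕ k)) x
    T≉0 : ∀ k → T k ≉ 0#
    T≉0 k = pow-nonzero (q ℕ.^ suc (toℕ k) ℕ.+ 1) x≉0
    α : Alphas
    α k = (ν * a (Fin.suc k)) * T k ⁻¹⟨ T≉0 k ⟩
    α≉0 : AllNonzero α
    α≉0 k = *-nonzero (*-nonzero ν≉0 (a≉0 (Fin.suc k))) (⁻¹-nonzero (T≉0 k))
    a≈μv : ∀ k → a k ≈ μ * vCoeffs α x k
    a≈μv Fin.zero = begin
      a₀              ≈⟨ *-identityˡ a₀ ⟨
      1# * a₀         ≈⟨ *-congʳ (*-inverseˡ ν ν≉0) ⟨
      (μ * ν) * a₀    ≈⟨ *-assoc μ ν a₀ ⟩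
      μ * (ν * a₀)    ≈⟨ *-congˡ xx≈νa₀ ⟨
      μ * (x * x)     ∎
    a≈μv (Fin.suc k) = begin
      b                                ≈⟨ *-identityʳ b ⟨
      b * 1#                           ≈⟨ *-cong (*-identityˡ b) (*-inverseˡ (T k) (T≉0 k)) ⟨
      (1# * b) * (T⁻¹ * T k)           ≈⟨ *-congʳ (*-congʳ (*-inverseˡ ν ν≉0)) ⟨
      ((μ * ν) * b) * (T⁻¹ * T k)      ≈⟨ solve 5 (λ μ ν b t⁻¹ t → ((μ ⊛ ν) ⊛ b) ⊛ (t⁻¹ ⊛ t) ⊜ μ ⊛ (((ν ⊛ b) ⊛ t⁻¹) ⊛ t))
                                                  refl μ ν b T⁻¹ (T k) ⟩
      μ * (α k * T k)                  ∎
      where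
      b = a (Fin.suc k)
      T⁻¹ = T k ⁻¹⟨ T≉0 k ⟩

  scaled-firstRow : ∀ {A μ c} → A ≋ scale μ (M c) → ∀ k → A Fin.zero (inject k) ≈ μ * c k
  scaled-firstRow {c = c} A≋μMc k = trans (A≋μMc Fin.zero (inject k)) (*-congˡ (M-firstRow c k))

  span-firstRow : ∀ {i A} → InSpanExcept i A → A Fin.zero (inject i) ≈ 0#
  span-firstRow {i} (b , bᵢ≈0 , A≋Σb) =
    trans (A≋Σb Fin.zero (inject i)) (trans (sumΠ≋M b Fin.zero (inject i)) (trans (M-firstRow b i) bᵢ≈0))

  V-nonempty : ∀ α → Σ Mat (InV α)
  V-nonempty α = M (vCoeffs α 1#) , 1# , 1≉0 , 1# , InFq-1# , 1≉0 , λ i j → sym (*-identityˡ _)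

  InV⇒outside : ∀ {α} → AllNonzero α → ∀ {A} → InV α A →
              InW A × ¬ IsZero A × (∀ i → ¬ InSpanExcept i A)
  InV⇒outside {α} α≉0 {A} (x , x≉0 , μ , μ∈Fq , μ≉0 , A≋μMv) =
    (scaleCoeffs μ v , λ i j → trans (A≋μMv i j) (M-scale μ∈Fq v i j)) ,
    (λ A≈0 → firstRow-nonzero Fin.zero (A≈0 Fin.zero (inject Fin.zero))) ,
    (λ i A∈span → firstRow-nonzero i (span-firstRow A∈span))
    where
    v = vCoeffs α x
    firstRow-nonzero : ∀ k → A Fin.zero (inject k) ≉ 0#
    firstRow-nonzero k A₀ₖ≈0 =
      *-nonzero μ≉0 (vCoeffs-nonzero α≉0 x≉0 k) (trans (sym (scaled-firstRow A≋μMv k)) A₀ₖ≈0)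

  InV-resp-≋ : ∀ {α A B} → A ≋ B → InV α B → InV α A
  InV-resp-≋ A≋B (x , x≉0 , μ , μ∈Fq , μ≉0 , B≋μMv) =
    x , x≉0 , μ , μ∈Fq , μ≉0 , λ i j → trans (A≋B i j) (B≋μMv i j)

  outside⇒InV : ∀ {A} → InW A → (∀ i → ¬ InSpanExcept i A) → Σ Alphas λ α → AllNonzero α × InV α A
  outside⇒InV {A} (a , A≋Ma) A∉span = map₂ (map₂ (InV-resp-≋ A≋Ma)) (nonzeroCoeffs⇒InV a≉0)
    where
    a≉0 : ∀ k → a k ≉ 0#
    a≉0 k aₖ≈0 = A∉span k (a , aₖ≈0 , λ i j → trans (A≋Ma i j) (sym (sumΠ≋M a i j)))

  InV-unique : ∀ {α β A} → InV α A → InV β A → ∀ k → α k ≈ β k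
  InV-unique {α} {β} (x , x≉0 , ν , ν∈Fq , ν≉0 , A≋νMv) (y , y≉0 , μ , μ∈Fq , μ≉0 , A≋μMw) k =
    twist-coefficient-unique (suc (toℕ k)) ν∈Fq μ∈Fq ν≉0 μ≉0 x≉0 y≉0 (firstRows Fin.zero) (firstRows (Fin.suc k))
    where
    firstRows : ∀ k → ν * vCoeffs α x k ≈ μ * vCoeffs β y k
    firstRows k = trans (sym (scaled-firstRow A≋νMv k)) (scaled-firstRow A≋μMw k)

open import Data.Nat using (_*_; _^_; _<_; _≤_)

lemma4p3 : (q : ℕ) → IsPrimePower q → 2 < q → (n : ℕ) → 1 ≤ n →
    (R : CommutativeRing 0ℓ 0ℓ) → IsField R → HasCard R (q ^ suc (2 * n)) →
    let open WithField R q n in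
    -- each 𝒱_α is a nonempty set of points of PG(W) lying in none of the subspaces
    ((α : Alphas) → AllNonzero α → Σ Mat (λ A → InV α A))
    × ((α : Alphas) → AllNonzero α → (A : Mat) → InV α A →
         InW A × ¬ IsZero A × ((i : Fin (suc n)) → ¬ InSpanExcept i A))
    -- every such point lies in some 𝒱_α
    × ((A : Mat) → InW A → ¬ IsZero A → ((i : Fin (suc n)) → ¬ InSpanExcept i A) →
         Σ Alphas (λ α → AllNonzero α × InV α A))
    -- the 𝒱_α are pairwise disjoint
    × ((α β : Alphas) → AllNonzero α → AllNonzero β → (A : Mat) →
         InV α A → InV β A → (k : Fin n) → CommutativeRing._≈_ R (α k) (β k))
lemma4p3 q _ 2<q n _ R isField card =
    (λ α _ → V-nonempty α) ,
    (λ α α≉0 A → InV⇒outside α≉0) ,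
    (λ A A∈W _ → outside⇒InV A∈W) ,
    (λ α β _ _ A → InV-unique)
  where open Partition R isField q n (ℕₚ.m<n⇒n≢0 2<q) card
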